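{- (1) $\mathsf{IQC}+\{\mathrm{CD},\mathrm{SW}\}\nvdash\mathrm{ED}$. (2) $\mathsf{IQC}+\{\mathrm{CD},\mathrm{ED}\}\nvdash\mathrm{SW}$. (3) $\mathsf{IQC}+\mathrm{SW}\vdash\mathrm{CD}$. (4) $\mathsf{IQC}+\mathrm{ED}\nvdash\mathrm{CD}$.
   Context: For a set of schemas, $\mathsf{IQC}+\{\dots\}$ is the smallest set of first-order formulas containing intuitionistic predicate logic and all instances of the schemas, closed under the rules of $\mathsf{IQC}$. "$L\vdash X$" for a schema $X$ means every instance of $X$ is derivable; "$L\nvdash X$" means some instance is not. Schemas (for formulas $A(x),B$ with $x$ not free in $B$): $\mathrm{CD}$: $\forall x(A(x)\vee B)\to\forall xA(x)\vee B$; $\mathrm{ED}$: $(B\to\exists xA(x))\to\exists x(B\to A(x))$; $\mathrm{SW}$: $(\forall xA(x)\to B)\to\exists x(A(x)\to B)$. -}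

module Defs where

open import Data.Nat using (ℕ; zero; suc)
open import Data.List using (List; map)
open import Data.Product using (Σ; ∃; _×_; _,_)
open import Data.Sum using (_⊎_)
open import Relation.Nullary using (¬_)
open import Relation.Binary.PropositionalEquality using (_≡_)

-- First-order language: countably many predicate symbols (of every arity,
-- the arity being the length of the argument list), no function symbols,
-- no equality.  Variables are de Bruijn indices; terms are variables.
Term : Set
Term = ℕ

infixr 6 _∧'_
infixr 5 _∨'_
infixr 4 _⇒_

data Formula : Set where
  atom : ℕ → List Term → Formula
  ⊥'   : Formula
  _∧'_ : Formula → Formula → Formula
  _∨'_ : Formula → Formula → Formula
  _⇒_  : Formula → Formula → Formula
  ∀'   : Formula → Formula
  ∃'   : Formula → Formula

liftR : (ℕ → ℕ) → ℕ → ℕ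
liftR ρ zero    = zero
liftR ρ (suc n) = suc (ρ n)

rename : (ℕ → ℕ) → Formula → Formula
rename ρ (atom P ts) = atom P (map ρ ts)
rename ρ ⊥'          = ⊥'
rename ρ (A ∧' B)    = rename ρ A ∧' rename ρ B
rename ρ (A ∨' B)    = rename ρ A ∨' rename ρ B
rename ρ (A ⇒ B)     = rename ρ A ⇒ rename ρ B
rename ρ (∀' A)      = ∀' (rename (liftR ρ) A)
rename ρ (∃' A)      = ∃' (rename (liftR ρ) A)

shift : Formula → Formula
shift = rename suc

instSub : Term → ℕ → ℕ
instSub t zero    = t
instSub t (suc n) = n

inst : Formula → Term → Formula
inst A t = rename (instSub t) A

infix 2 _⊢_
data _⊢_ (Γ : Formula → Set) : Formula → Set where
  ax    : ∀ {A} → Γ A → Γ ⊢ A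
  K     : ∀ {A B} → Γ ⊢ A ⇒ B ⇒ A
  S     : ∀ {A B C} → Γ ⊢ (A ⇒ B ⇒ C) ⇒ (A ⇒ B) ⇒ A ⇒ C
  ∧I    : ∀ {A B} → Γ ⊢ A ⇒ B ⇒ A ∧' B
  ∧E₁   : ∀ {A B} → Γ ⊢ A ∧' B ⇒ A
  ∧E₂   : ∀ {A B} → Γ ⊢ A ∧' B ⇒ B
  ∨I₁   : ∀ {A B} → Γ ⊢ A ⇒ A ∨' B
  ∨I₂   : ∀ {A B} → Γ ⊢ B ⇒ A ∨' B
  ∨E    : ∀ {A B C} → Γ ⊢ (A ⇒ C) ⇒ (B ⇒ C) ⇒ A ∨' B ⇒ C
  ⊥E    : ∀ {A} → Γ ⊢ ⊥' ⇒ A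
  ∀E    : ∀ {A} t → Γ ⊢ ∀' A ⇒ inst A t
  ∃I    : ∀ {A} t → Γ ⊢ inst A t ⇒ ∃' A
  mp    : ∀ {A B} → Γ ⊢ A ⇒ B → Γ ⊢ A → Γ ⊢ B
  ∀R    : ∀ {A B} → Γ ⊢ shift B ⇒ A → Γ ⊢ B ⇒ ∀' A
  ∃R    : ∀ {A B} → Γ ⊢ A ⇒ shift B → Γ ⊢ ∃' A ⇒ B

-- Schema instances.  A is the body of the quantifier (bound variable x =
-- index 0); "x not free in B" is expressed by using shift B under the binder.
cd : Formula → Formula → Formula
cd A B = ∀' (A ∨' shift B) ⇒ (∀' A ∨' B)

ed : Formula → Formula → Formula
ed A B = (B ⇒ ∃' A) ⇒ ∃' (shift B ⇒ A)

sw : Formula → Formula → Formula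
sw A B = (∀' A ⇒ B) ⇒ ∃' (A ⇒ shift B)

CD ED SW : Formula → Set
CD φ = Σ Formula λ A → Σ Formula λ B → φ ≡ cd A B
ED φ = Σ Formula λ A → Σ Formula λ B → φ ≡ ed A B
SW φ = Σ Formula λ A → Σ Formula λ B → φ ≡ sw A B

_∪_ : (Formula → Set) → (Formula → Set) → Formula → Set
(X ∪ Y) φ = X φ ⊎ Y φ

Derives : (Formula → Set) → (Formula → Formula → Formula) → Set
Derives L X = ∀ A B → L ⊢ X A B

NotDerives : (Formula → Set) → (Formula → Formula → Formula) → Set
NotDerives L X = Σ Formula λ A → Σ Formula λ B → ¬ (L ⊢ X A B)

-- The other three are independence results,
-- each witnessed by a Kripke countermodel whose validities come from frame
-- conditions: constant domains validate CD; together with a linear well-founded frame they validate ED,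
-- and with a linear conversely well-founded frame SW.  So the chain ω with constant
-- domain satisfies CD and ED but refutes an instance of SW, and a root below a
-- descending ω-chain satisfies CD and SW but refutes one of ED.  For (4), the chain
-- ω whose domains grow by a newborn element at each world refutes CD; ED survives
-- because the element that witnesses ∃x A at a world behaves, one world later,
-- exactly like the element 0, which exists from the start.
module Submission where

open import Defs
open import Data.Empty using (⊥; ⊥-elim)
open import Data.List using (List; []; _∷_; map)
open import Data.List.Properties using (map-cong; map-∘; map-id)
open import Data.Nat using (ℕ; zero; suc; pred; _≤_; z≤n; s≤s; _≤?_)
open import Data.Nat.Induction using (<-rec; <-wellFounded)
open import Data.Nat.Properties
  using (≤-refl; ≤-trans; ≤-total; ≰⇒>; ≤-<-trans; m≤n⇒m<n∨m≡n; 1+n≰n; n≤1+n;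
         pred-mono-≤; <⇒≤pred; ≤pred⇒≤)
open import Data.Product using (Σ; _×_; _,_)
open import Data.Sum using (_⊎_; inj₁; inj₂; [_,_])
open import Data.Unit using (⊤; tt)
open import Function using (_∘_; flip; _⇔_; mk⇔; Equivalence)
open import Induction.WellFounded using (WellFounded; Acc; acc; module All; module Subrelation)
open import Relation.Binary.Definitions using (Total)
open import Relation.Binary.PropositionalEquality using (_≡_; refl; sym; trans; cong; cong₂; subst)
open import Relation.Nullary using (¬_; yes; no)
open import Relation.Nullary.Decidable using (decidable-stable)
open import Relation.Nullary.Negation using (Stable)

open Equivalence using (to; from)

¬¬-minimal : {W : Set} {_<_ : W → W → Set} → WellFounded _<_ →
             (P : W → Set) {w : W} → P w →
             ¬ ¬ Σ W λ m → P m × (∀ {v} → v < m → ¬ P v)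
¬¬-minimal wf P {w} pw noMinimal =
  All.wfRec wf _ (λ w → ¬ P w) (λ m below pm → noMinimal (m , pm , below)) w pw

liftR-cancel : ∀ {f g : ℕ → ℕ} → (∀ i → f (g i) ≡ i) → ∀ i → liftR f (liftR g i) ≡ i
liftR-cancel e zero    = refl
liftR-cancel e (suc i) = cong suc (e i)

rename-cancel : ∀ φ {f g : ℕ → ℕ} → (∀ i → f (g i) ≡ i) → rename f (rename g φ) ≡ φ
rename-cancel (atom P ts) e =
  cong (atom P) (trans (sym (map-∘ ts)) (trans (map-cong e ts) (map-id ts)))
rename-cancel ⊥'          e = refl
rename-cancel (A ∧' B)    e = cong₂ _∧'_ (rename-cancel A e) (rename-cancel B e)
rename-cancel (A ∨' B)    e = cong₂ _∨'_ (rename-cancel A e) (rename-cancel B e)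
rename-cancel (A ⇒ B)     e = cong₂ _⇒_ (rename-cancel A e) (rename-cancel B e)
rename-cancel (∀' A)      e = cong ∀' (rename-cancel A (liftR-cancel e))
rename-cancel (∃' A)      e = cong ∃' (rename-cancel A (liftR-cancel e))

inst-liftR-shift : ∀ A → inst (rename (liftR suc) A) 0 ≡ A
inst-liftR-shift A = rename-cancel A λ { zero → refl ; (suc i) → refl }

module _ {Γ : Formula → Set} where

  ⇒-trans : ∀ {P Q R} → Γ ⊢ P ⇒ Q → Γ ⊢ Q ⇒ R → Γ ⊢ P ⇒ R
  ⇒-trans f g = mp (mp S (mp K g)) f

  ⇒-apply₂ : ∀ {P Q R} → Γ ⊢ P ⇒ Q ⇒ R → Γ ⊢ Q → Γ ⊢ P ⇒ R
  ⇒-apply₂ f q = mp (mp S f) (mp K q)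

  ⇒-precompose : ∀ {P Q R} → Γ ⊢ P ⇒ Q → Γ ⊢ (Q ⇒ R) ⇒ (P ⇒ R)
  ⇒-precompose = ⇒-apply₂ (mp (mp S (mp K S)) K)

-- SW at the formula ∀x A ∨ B, whose premise is ∨I₁, yields ∃x (A → ∀x A ∨ B);
-- under the hypothesis ∀x (A ∨ B) both cases of A(x) ∨ B then give ∀x A ∨ B.
sw⊢cd : Derives SW cd
sw⊢cd A B = mp (∃R (⇒-trans (⇒-apply₂ ∨E ∨I₂) (⇒-precompose instantiate)))
               (mp (ax (A , ∀' A ∨' B , refl)) ∨I₁)
  where
  instantiate : SW ⊢ shift (∀' (A ∨' shift B)) ⇒ A ∨' shift B
  instantiate = subst (λ C → SW ⊢ shift (∀' (A ∨' shift B)) ⇒ C)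
                      (cong₂ _∨'_ (inst-liftR-shift A) (inst-liftR-shift (shift B)))
                      (∀E 0)

Env : Set
Env = ℕ → ℕ

extend : ℕ → Env → Env
extend d ρ zero    = d
extend d ρ (suc i) = ρ i

record KripkeModel : Set₁ where
  field
    W        : Set
    _≼_      : W → W → Set
    ≼-refl   : ∀ {w} → w ≼ w
    ≼-trans  : ∀ {u v w} → u ≼ v → v ≼ w → u ≼ w
    Dom      : W → ℕ → Set
    Dom-mono : ∀ {w u d} → w ≼ u → Dom w d → Dom u d
    I        : W → ℕ → List ℕ → Set
    I-mono   : ∀ {w u P ts} → w ≼ u → I w P ts → I u P ts
    I-stable : ∀ {w P ts} → Stable (I w P ts)

module Forcing (M : KripkeModel) where
  open KripkeModel M

  -- Disjunction and ∃ are read through ¬¬, so every forced formula is ¬¬-stable: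
  -- this is classical Kripke semantics, carried out in a constructive metatheory.
  _⊩_[_] : W → Formula → Env → Set
  w ⊩ atom P ts [ ρ ] = I w P (map ρ ts)
  w ⊩ ⊥'        [ ρ ] = ⊥
  w ⊩ A ∧' B    [ ρ ] = w ⊩ A [ ρ ] × w ⊩ B [ ρ ]
  w ⊩ A ∨' B    [ ρ ] = ¬ ¬ (w ⊩ A [ ρ ] ⊎ w ⊩ B [ ρ ])
  w ⊩ A ⇒ B     [ ρ ] = ∀ u → w ≼ u → u ⊩ A [ ρ ] → u ⊩ B [ ρ ]
  w ⊩ ∀' A      [ ρ ] = ∀ u → w ≼ u → ∀ d → Dom u d → u ⊩ A [ extend d ρ ]
  w ⊩ ∃' A      [ ρ ] = ¬ ¬ Σ ℕ λ d → Dom w d × w ⊩ A [ extend d ρ ]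

  ⊩-stable : ∀ φ {w ρ} → Stable (w ⊩ φ [ ρ ])
  ⊩-stable (atom P ts) h = I-stable h
  ⊩-stable ⊥'          h = h (λ ())
  ⊩-stable (A ∧' B)    h = ⊩-stable A (λ ¬a → h (λ (a , _) → ¬a a)) ,
                           ⊩-stable B (λ ¬b → h (λ (_ , b) → ¬b b))
  ⊩-stable (A ∨' B)    h = λ ¬a∨b → h (λ ¬¬a∨b → ¬¬a∨b ¬a∨b)
  ⊩-stable (A ⇒ B)     h = λ u w≼u a → ⊩-stable B (λ ¬b → h (λ f → ¬b (f u w≼u a)))
  ⊩-stable (∀' A)      h = λ u w≼u d d∈u → ⊩-stable A (λ ¬a → h (λ f → ¬a (f u w≼u d d∈u)))
  ⊩-stable (∃' A)      h = λ ¬e → h (λ ¬¬e → ¬¬e ¬e)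

  ⊩-from-¬¬ : ∀ φ {w ρ} {X : Set} → ¬ ¬ X → (X → w ⊩ φ [ ρ ]) → w ⊩ φ [ ρ ]
  ⊩-from-¬¬ φ ¬¬x f = ⊩-stable φ (λ ¬goal → ¬¬x (λ x → ¬goal (f x)))

  ⊩-cases : ∀ φ {w ρ} (X : Set) → (X → w ⊩ φ [ ρ ]) → (¬ X → w ⊩ φ [ ρ ]) → w ⊩ φ [ ρ ]
  ⊩-cases φ X if-x if-¬x = ⊩-stable φ (λ ¬goal → ¬goal (if-¬x (λ x → ¬goal (if-x x))))

  ⊩-mono : ∀ φ {w u ρ} → w ≼ u → w ⊩ φ [ ρ ] → u ⊩ φ [ ρ ]
  ⊩-mono (atom P ts) w≼u a = I-mono w≼u a
  ⊩-mono ⊥'          w≼u ()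
  ⊩-mono (A ∧' B)    w≼u (a , b) = ⊩-mono A w≼u a , ⊩-mono B w≼u b
  ⊩-mono (A ∨' B)    w≼u h ¬a∨b =
    h λ { (inj₁ a) → ¬a∨b (inj₁ (⊩-mono A w≼u a)) ; (inj₂ b) → ¬a∨b (inj₂ (⊩-mono B w≼u b)) }
  ⊩-mono (A ⇒ B)     w≼u f v u≼v = f v (≼-trans w≼u u≼v)
  ⊩-mono (∀' A)      w≼u f v u≼v = f v (≼-trans w≼u u≼v)
  ⊩-mono (∃' A)      w≼u h ¬e = h (λ (d , d∈w , a) → ¬e (d , Dom-mono w≼u d∈w , ⊩-mono A w≼u a))

  extend-liftR : ∀ {σ : ℕ → ℕ} {ρ ρ' : Env} d → (∀ i → ρ (σ i) ≡ ρ' i) →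
                 ∀ i → extend d ρ (liftR σ i) ≡ extend d ρ' i
  extend-liftR d e zero    = refl
  extend-liftR d e (suc i) = e i

  ⊩-rename : ∀ φ {w σ ρ ρ'} → (∀ i → ρ (σ i) ≡ ρ' i) → (w ⊩ rename σ φ [ ρ ]) ⇔ (w ⊩ φ [ ρ' ])
  ⊩-rename (atom P ts) {w} {σ} {ρ} {ρ'} e = mk⇔ (subst (I w P) ρσ≡ρ') (subst (I w P) (sym ρσ≡ρ'))
    where
    ρσ≡ρ' : map ρ (map σ ts) ≡ map ρ' ts
    ρσ≡ρ' = trans (sym (map-∘ ts)) (map-cong e ts)
  ⊩-rename ⊥'       e = mk⇔ (λ x → x) (λ x → x)
  ⊩-rename (A ∧' B) e = mk⇔ (λ (a , b) → to (⊩-rename A e) a , to (⊩-rename B e) b)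
                            (λ (a , b) → from (⊩-rename A e) a , from (⊩-rename B e) b)
  ⊩-rename (A ∨' B) e =
    mk⇔ (λ h ¬a∨b → h λ { (inj₁ a) → ¬a∨b (inj₁ (to (⊩-rename A e) a))
                        ; (inj₂ b) → ¬a∨b (inj₂ (to (⊩-rename B e) b)) })
        (λ h ¬a∨b → h λ { (inj₁ a) → ¬a∨b (inj₁ (from (⊩-rename A e) a))
                        ; (inj₂ b) → ¬a∨b (inj₂ (from (⊩-rename B e) b)) })
  ⊩-rename (A ⇒ B) e =
    mk⇔ (λ f u w≼u a → to (⊩-rename B e) (f u w≼u (from (⊩-rename A e) a)))
        (λ f u w≼u a → from (⊩-rename B e) (f u w≼u (to (⊩-rename A e) a)))
  ⊩-rename (∀' A) e =
    mk⇔ (λ f u w≼u d d∈u → to (⊩-rename A (extend-liftR d e)) (f u w≼u d d∈u))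
        (λ f u w≼u d d∈u → from (⊩-rename A (extend-liftR d e)) (f u w≼u d d∈u))
  ⊩-rename (∃' A) e =
    mk⇔ (λ h ¬e → h (λ (d , d∈w , a) → ¬e (d , d∈w , to (⊩-rename A (extend-liftR d e)) a)))
        (λ h ¬e → h (λ (d , d∈w , a) → ¬e (d , d∈w , from (⊩-rename A (extend-liftR d e)) a)))

  ⊩-shift : ∀ B {w d ρ} → (w ⊩ shift B [ extend d ρ ]) ⇔ (w ⊩ B [ ρ ])
  ⊩-shift B = ⊩-rename B (λ _ → refl)

  ⊩-inst : ∀ A t {w ρ} → (w ⊩ inst A t [ ρ ]) ⇔ (w ⊩ A [ extend (ρ t) ρ ])
  ⊩-inst A t = ⊩-rename A λ { zero → refl ; (suc i) → refl }

  InDomain : W → Env → Set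
  InDomain w ρ = ∀ i → Dom w (ρ i)

  InDomain-extend : ∀ {w ρ d} → Dom w d → InDomain w ρ → InDomain w (extend d ρ)
  InDomain-extend d∈w ρ∈w zero    = d∈w
  InDomain-extend d∈w ρ∈w (suc i) = ρ∈w i

  Valid : Formula → Set
  Valid φ = ∀ w ρ → InDomain w ρ → w ⊩ φ [ ρ ]

  Validates : (Formula → Set) → Set
  Validates Γ = ∀ {ψ} → Γ ψ → Valid ψ

  validates-∪ : ∀ {Γ Δ} → Validates Γ → Validates Δ → Validates (Γ ∪ Δ)
  validates-∪ Γ-valid Δ-valid (inj₁ γ) = Γ-valid γ
  validates-∪ Γ-valid Δ-valid (inj₂ δ) = Δ-valid δ

  validates-schema : ∀ (X : Formula → Formula → Formula) → (∀ A B → Valid (X A B)) →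
                     Validates (λ φ → Σ Formula λ A → Σ Formula λ B → φ ≡ X A B)
  validates-schema X X-valid (A , B , refl) = X-valid A B

  soundness : ∀ {Γ} → Validates Γ → ∀ {φ} → Γ ⊢ φ → Valid φ
  soundness Γ-valid (ax γ) = Γ-valid γ
  soundness Γ-valid (K {A}) w ρ ρ∈w u _ a v u≼v _ = ⊩-mono A u≼v a
  soundness Γ-valid S w ρ ρ∈w u _ f v u≼v g x v≼x a =
    f x (≼-trans u≼v v≼x) a x ≼-refl (g x v≼x a)
  soundness Γ-valid (∧I {A}) w ρ ρ∈w u _ a v u≼v b = ⊩-mono A u≼v a , b
  soundness Γ-valid ∧E₁ w ρ ρ∈w u _ (a , b) = a
  soundness Γ-valid ∧E₂ w ρ ρ∈w u _ (a , b) = b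
  soundness Γ-valid ∨I₁ w ρ ρ∈w u _ a ¬a∨b = ¬a∨b (inj₁ a)
  soundness Γ-valid ∨I₂ w ρ ρ∈w u _ b ¬a∨b = ¬a∨b (inj₂ b)
  soundness Γ-valid (∨E {C = C}) w ρ ρ∈w u _ f v u≼v g x v≼x h =
    ⊩-from-¬¬ C h λ { (inj₁ a) → f x (≼-trans u≼v v≼x) a ; (inj₂ b) → g x v≼x b }
  soundness Γ-valid ⊥E w ρ ρ∈w u _ ()
  soundness Γ-valid (∀E {A} t) w ρ ρ∈w u w≼u f =
    from (⊩-inst A t) (f u ≼-refl (ρ t) (Dom-mono w≼u (ρ∈w t)))
  soundness Γ-valid (∃I {A} t) w ρ ρ∈w u w≼u a ¬e =
    ¬e (ρ t , Dom-mono w≼u (ρ∈w t) , to (⊩-inst A t) a)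
  soundness Γ-valid (mp d e) w ρ ρ∈w =
    soundness Γ-valid d w ρ ρ∈w w ≼-refl (soundness Γ-valid e w ρ ρ∈w)
  soundness Γ-valid (∀R {A} {B} d) w ρ ρ∈w u w≼u b v u≼v x x∈v =
    soundness Γ-valid d v (extend x ρ) (InDomain-extend x∈v (Dom-mono (≼-trans w≼u u≼v) ∘ ρ∈w))
      v ≼-refl (from (⊩-shift B) (⊩-mono B u≼v b))
  soundness Γ-valid (∃R {A} {B} d) w ρ ρ∈w u w≼u h =
    ⊩-from-¬¬ B h λ (x , x∈u , a) →
      to (⊩-shift B)
         (soundness Γ-valid d u (extend x ρ) (InDomain-extend x∈u (Dom-mono w≼u ∘ ρ∈w)) u ≼-refl a)

  underivable : ∀ {Γ φ} → Validates Γ → ¬ Valid φ → ¬ (Γ ⊢ φ)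
  underivable Γ-valid φ-invalid = φ-invalid ∘ soundness Γ-valid

  _≺_ : W → W → Set
  v ≺ w = v ≼ w × ¬ w ≼ v

  ConstantDomain : Set
  ConstantDomain = ∀ {w u d} → w ≼ u → Dom u d → Dom w d

  ¬⊩∀⇒counterexample : ∀ A {w ρ} → ¬ w ⊩ ∀' A [ ρ ] →
                       ¬ ¬ Σ W λ v → w ≼ v × Σ ℕ λ d → Dom v d × ¬ v ⊩ A [ extend d ρ ]
  ¬⊩∀⇒counterexample A ¬∀a ¬counterexample =
    ¬∀a λ v w≼v d d∈v → ⊩-stable A λ ¬a → ¬counterexample (v , w≼v , d , d∈v , ¬a)

  -- With constant domains an element d of a later world can be tested against the
  -- hypothesis ∀x (A ∨ B) already at the current world u.
  cd-valid : ConstantDomain → ∀ A B → Valid (cd A B)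
  cd-valid const A B w ρ _ u _ h =
    ⊩-cases (∀' A ∨' B) (u ⊩ B [ ρ ]) (λ b ¬a∨b → ¬a∨b (inj₂ b)) λ ¬b ¬a∨b →
      ¬a∨b (inj₁ λ v u≼v d d∈v →
        ⊩-from-¬¬ A (h u ≼-refl d (const u≼v d∈v)) λ
          { (inj₁ a) → ⊩-mono A u≼v a
          ; (inj₂ b) → ⊥-elim (¬b (to (⊩-shift B) b)) })

  -- A minimal world m above u forcing B supplies the witness; by linearity every
  -- other world above u forcing B lies above m.
  ed-valid : ConstantDomain → Total _≼_ → WellFounded _≺_ → ∀ A B → Valid (ed A B)
  ed-valid const total wf A B w ρ ρ∈w u w≼u H = ⊩-cases goal (Σ W ForcesB) someB noB
    where
    goal : Formula
    goal = ∃' (shift B ⇒ A)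

    ForcesB : W → Set
    ForcesB v = u ≼ v × v ⊩ B [ ρ ]

    noB : ¬ Σ W ForcesB → u ⊩ goal [ ρ ]
    noB ¬b ¬e =
      ¬e (ρ 0 , Dom-mono w≼u (ρ∈w 0) , λ v u≼v b → ⊥-elim (¬b (v , u≼v , to (⊩-shift B) b)))

    someB : Σ W ForcesB → u ⊩ goal [ ρ ]
    someB (v , bv) =
      ⊩-from-¬¬ goal (¬¬-minimal wf ForcesB bv) λ (m , (u≼m , bm) , minimal) →
        ⊩-from-¬¬ goal (H m u≼m bm) λ (d , d∈m , am) ¬e →
          ¬e (d , const u≼m d∈m , λ x u≼x b → ⊩-stable A λ ¬ax →
            [ (λ m≼x → ¬ax (⊩-mono A m≼x am))
            , (λ x≼m → minimal (x≼m , λ m≼x → ¬ax (⊩-mono A m≼x am)) (u≼x , to (⊩-shift B) b))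
            ] (total m x))

  -- Take m maximal above u among the worlds refuting ∀x A, and d with m ⊮ A(d).  A world
  -- above u forcing A(d) is not below m, so it lies strictly above m and forces ∀x A.
  sw-valid : ConstantDomain → Total _≼_ → WellFounded (flip _≺_) → ∀ A B → Valid (sw A B)
  sw-valid const total wf A B w ρ ρ∈w u w≼u H = ⊩-cases goal (u ⊩ ∀' A [ ρ ]) allA notAllA
    where
    goal : Formula
    goal = ∃' (A ⇒ shift B)

    allA : u ⊩ ∀' A [ ρ ] → u ⊩ goal [ ρ ]
    allA ∀a ¬e = ¬e (ρ 0 , Dom-mono w≼u (ρ∈w 0) , λ v u≼v _ →
                   from (⊩-shift B) (H v u≼v (⊩-mono (∀' A) u≼v ∀a)))

    Refutes : W → Set
    Refutes v = u ≼ v × ¬ v ⊩ ∀' A [ ρ ]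

    notAllA : ¬ u ⊩ ∀' A [ ρ ] → u ⊩ goal [ ρ ]
    notAllA ¬∀a =
      ⊩-from-¬¬ goal (¬¬-minimal wf Refutes (≼-refl , ¬∀a)) λ (m , (u≼m , ¬∀m) , maximal) →
        ⊩-from-¬¬ goal (¬⊩∀⇒counterexample A ¬∀m) λ (v , m≼v , d , d∈v , ¬av) ¬e →
          let ¬am : ¬ m ⊩ A [ extend d ρ ]
              ¬am am = ¬av (⊩-mono A m≼v am)
          in ¬e (d , const (≼-trans u≼m m≼v) d∈v , λ x u≼x ax →
               from (⊩-shift B) (H x u≼x (⊩-stable (∀' A) λ ¬∀x →
                 [ (λ x≼m → ¬am (⊩-mono A x≼m ax))
                 , (λ m≼x → maximal (m≼x , λ x≼m → ¬am (⊩-mono A x≼m ax)) (u≼x , ¬∀x))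
                 ] (total x m))))

  record Bisimulation : Set₁ where
    field
      Related        : W → Env → W → Env → Set
      symmetric      : ∀ {w ρ w' ρ'} → Related w ρ w' ρ' → Related w' ρ' w ρ
      atom-preserved : ∀ {w ρ w' ρ' P ts} → Related w ρ w' ρ' →
                       w ⊩ atom P ts [ ρ ] → w' ⊩ atom P ts [ ρ' ]
      forth-world    : ∀ {w ρ w' ρ' u} → Related w ρ w' ρ' → w ≼ u →
                       Σ W λ u' → w' ≼ u' × Related u ρ u' ρ'
      forth-element  : ∀ {w ρ w' ρ' d} → Related w ρ w' ρ' → Dom w d →
                       Σ ℕ λ d' → Dom w' d' × Related w (extend d ρ) w' (extend d' ρ')

    ⊩-preserved : ∀ φ {w ρ w' ρ'} → Related w ρ w' ρ' → w ⊩ φ [ ρ ] → w' ⊩ φ [ ρ' ]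
    ⊩-preserved (atom P ts) r a = atom-preserved r a
    ⊩-preserved ⊥'          r ()
    ⊩-preserved (A ∧' B)    r (a , b) = ⊩-preserved A r a , ⊩-preserved B r b
    ⊩-preserved (A ∨' B)    r h ¬a∨b =
      h λ { (inj₁ a) → ¬a∨b (inj₁ (⊩-preserved A r a))
          ; (inj₂ b) → ¬a∨b (inj₂ (⊩-preserved B r b)) }
    ⊩-preserved (A ⇒ B)     r f u' w'≼u' a' =
      let u , w≼u , r' = forth-world (symmetric r) w'≼u'
      in ⊩-preserved B (symmetric r') (f u w≼u (⊩-preserved A r' a'))
    ⊩-preserved (∀' A)      r f u' w'≼u' d' d'∈u' =
      let u , w≼u , r'  = forth-world (symmetric r) w'≼u'
          d , d∈u , r'' = forth-element r' d'∈u'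
      in ⊩-preserved A (symmetric r'') (f u w≼u d d∈u)
    ⊩-preserved (∃' A)      r h ¬e =
      h λ (d , d∈w , a) → let d' , d'∈w' , r' = forth-element r d∈w
                          in ¬e (d' , d'∈w' , ⊩-preserved A r' a)

Px Q : Formula
Px = atom 0 (0 ∷ [])
Q  = atom 1 []

module RootedDescendingChain where

  data World : Set where
    root : World
    node : ℕ → World

  -- root ≼ ⋯ ≼ node 2 ≼ node 1 ≼ node 0
  _≼_ : World → World → Set
  root   ≼ _      = ⊤
  node i ≼ root   = ⊥
  node i ≼ node j = j ≤ i

  ≼-refl : ∀ {w} → w ≼ w
  ≼-refl {root}   = tt
  ≼-refl {node i} = ≤-refl

  ≼-trans : ∀ {u v w} → u ≼ v → v ≼ w → u ≼ w
  ≼-trans {root}                     _   _   = tt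
  ≼-trans {node i} {node j} {node k} j≤i k≤j = ≤-trans k≤j j≤i

  ≼-total : Total _≼_
  ≼-total root     _        = inj₁ tt
  ≼-total (node i) root     = inj₂ tt
  ≼-total (node i) (node j) = ≤-total j i

  I : World → ℕ → List ℕ → Set
  I (node i) 0 (t ∷ _) = i ≤ t
  I (node i) 1 _       = ⊤
  I _        _ _       = ⊥

  I-mono : ∀ {w u P ts} → w ≼ u → I w P ts → I u P ts
  I-mono {node i} {node j} {0} {t ∷ _} j≤i i≤t = ≤-trans j≤i i≤t
  I-mono {node i} {node j} {1}         _   _   = tt

  I-stable : ∀ {w P ts} → Stable (I w P ts)
  I-stable {node i} {0} {t ∷ _}   = decidable-stable (i ≤? t)
  I-stable {node i} {1}           = λ _ → tt
  I-stable {root}                 = λ h → h (λ ())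
  I-stable {node i} {0} {[]}      = λ h → h (λ ())
  I-stable {node i} {suc (suc _)} = λ h → h (λ ())

  model : KripkeModel
  model = record { W = World ; _≼_ = _≼_ ; ≼-refl = ≼-refl ; ≼-trans = ≼-trans
                 ; Dom = λ _ _ → ⊤ ; Dom-mono = λ _ _ → tt
                 ; I = I ; I-mono = I-mono ; I-stable = I-stable }

  open Forcing model

  node-accessible : ∀ i → Acc (flip _≺_) (node i)
  node-accessible = <-rec _ λ i below → acc λ { {node j} (j≤i , i≰j) → below (≰⇒> i≰j) }

  conversely-wellFounded : WellFounded (flip _≺_)
  conversely-wellFounded (node i) = node-accessible i
  conversely-wellFounded root     =
    acc λ { {node j} _ → node-accessible j ; {root} (_ , root⋠root) → ⊥-elim (root⋠root tt) }

  ed-invalid : ¬ Valid (ed Px Q)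
  ed-invalid valid = valid root (λ _ → 0) (λ _ → tt) root tt
    (λ { root _ () ; (node j) _ _ ¬e → ¬e (j , tt , ≤-refl) })
    (λ (d , _ , Q⇒Pd) → 1+n≰n (Q⇒Pd (node (suc d)) tt tt))

  ed-underivable : ¬ (CD ∪ SW ⊢ ed Px Q)
  ed-underivable = underivable
    (validates-∪ {CD} {SW} (validates-schema cd (cd-valid (λ _ _ → tt)))
                           (validates-schema sw (sw-valid (λ _ _ → tt) ≼-total conversely-wellFounded)))
    ed-invalid

module OmegaChain where

  I : ℕ → ℕ → List ℕ → Set
  I k 0 (t ∷ _) = t ≤ k
  I _ _ _       = ⊥

  I-mono : ∀ {w u P ts} → w ≤ u → I w P ts → I u P ts
  I-mono {P = 0} {t ∷ _} w≤u t≤w = ≤-trans t≤w w≤u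

  I-stable : ∀ {w P ts} → Stable (I w P ts)
  I-stable {k} {0} {t ∷ _} = decidable-stable (t ≤? k)
  I-stable {k} {0} {[]}    = λ h → h (λ ())
  I-stable {k} {suc _}     = λ h → h (λ ())

  model : KripkeModel
  model = record { W = ℕ ; _≼_ = _≤_ ; ≼-refl = ≤-refl ; ≼-trans = ≤-trans
                 ; Dom = λ _ _ → ⊤ ; Dom-mono = λ _ _ → tt
                 ; I = I ; I-mono = I-mono ; I-stable = I-stable }

  open Forcing model

  wellFounded : WellFounded _≺_
  wellFounded = Subrelation.wellFounded (λ (_ , n≰m) → ≰⇒> n≰m) <-wellFounded

  sw-invalid : ¬ Valid (sw Px ⊥')
  sw-invalid valid = valid 0 (λ _ → 0) (λ _ → tt) 0 z≤n
    (λ u _ ∀xPx → 1+n≰n (∀xPx u ≤-refl (suc u) tt))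
    (λ (d , _ , ¬Pd) → ¬Pd d z≤n ≤-refl)

  sw-underivable : ¬ (CD ∪ ED ⊢ sw Px ⊥')
  sw-underivable = underivable
    (validates-∪ {CD} {ED} (validates-schema cd (cd-valid (λ _ _ → tt)))
                           (validates-schema ed (ed-valid (λ _ _ → tt) ≤-total wellFounded)))
    sw-invalid

module GrowingChain where

  -- World k has domain {0, …, k}, the element k being born at world k.  P x holds at
  -- world k iff x ≤ pred k: an element gets P one world after its birth, except 0,
  -- which has it already at the root.
  I : ℕ → ℕ → List ℕ → Set
  I k 0 (t ∷ _) = t ≤ pred k
  I k 1 _       = 1 ≤ k
  I _ _ _       = ⊥

  I-mono : ∀ {w u P ts} → w ≤ u → I w P ts → I u P ts
  I-mono {P = 0} {t ∷ _} w≤u t≤w = ≤-trans t≤w (pred-mono-≤ w≤u)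
  I-mono {P = 1}         w≤u 1≤w = ≤-trans 1≤w w≤u

  I-stable : ∀ {w P ts} → Stable (I w P ts)
  I-stable {k} {0} {t ∷ _}   = decidable-stable (t ≤? pred k)
  I-stable {k} {1}           = decidable-stable (1 ≤? k)
  I-stable {k} {0} {[]}      = λ h → h (λ ())
  I-stable {k} {suc (suc _)} = λ h → h (λ ())

  model : KripkeModel
  model = record { W = ℕ ; _≼_ = _≤_ ; ≼-refl = ≤-refl ; ≼-trans = ≤-trans
                 ; Dom = λ k d → d ≤ k ; Dom-mono = λ w≤u d≤w → ≤-trans d≤w w≤u
                 ; I = I ; I-mono = I-mono ; I-stable = I-stable }

  open Forcing model

  cd-invalid : ¬ Valid (cd Px Q)
  cd-invalid valid = valid 0 (λ _ → 0) (λ _ → z≤n) 0 z≤n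
    (λ { 0 _ 0 _ ¬P∨Q → ¬P∨Q (inj₁ z≤n) ; (suc u) _ _ _ ¬P∨Q → ¬P∨Q (inj₂ (s≤s z≤n)) })
    (λ { (inj₁ ∀xPx) → 1+n≰n (∀xPx 1 z≤n 1 ≤-refl) ; (inj₂ ()) })

  -- Forcing at (k, ρ) depends only on whether k = 0 and on which parameters are
  -- already old (have P) at k.
  record Similar (k : ℕ) (ρ : Env) (k' : ℕ) (ρ' : Env) : Set where
    field
      Q-iff     : 1 ≤ k ⇔ 1 ≤ k'
      ρ-in-dom  : ∀ i → ρ i ≤ k
      ρ'-in-dom : ∀ i → ρ' i ≤ k'
      P-iff     : ∀ i → ρ i ≤ pred k ⇔ ρ' i ≤ pred k'
  open Similar

  similar-sym : ∀ {k ρ k' ρ'} → Similar k ρ k' ρ' → Similar k' ρ' k ρ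
  similar-sym s = record { Q-iff = mk⇔ (from (Q-iff s)) (to (Q-iff s))
                         ; ρ-in-dom = ρ'-in-dom s ; ρ'-in-dom = ρ-in-dom s
                         ; P-iff = λ i → mk⇔ (from (P-iff s i)) (to (P-iff s i)) }

  all-old-similar : ∀ {k ρ k' ρ'} → 1 ≤ k → 1 ≤ k' →
                    (∀ i → ρ i ≤ pred k) → (∀ i → ρ' i ≤ pred k') → Similar k ρ k' ρ'
  all-old-similar 1≤k 1≤k' old old' =
    record { Q-iff = mk⇔ (λ _ → 1≤k') (λ _ → 1≤k)
           ; ρ-in-dom = ≤pred⇒≤ ∘ old ; ρ'-in-dom = ≤pred⇒≤ ∘ old'
           ; P-iff = λ i → mk⇔ (λ _ → old' i) (λ _ → old i) }

  extend-similar : ∀ {k ρ k' ρ' d d'} → Similar k ρ k' ρ' → d ≤ k → d' ≤ k' →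
                   (d ≤ pred k ⇔ d' ≤ pred k') → Similar k (extend d ρ) k' (extend d' ρ')
  extend-similar s d≤k d'≤k' d-iff =
    record { Q-iff = Q-iff s
           ; ρ-in-dom  = λ { zero → d≤k  ; (suc i) → ρ-in-dom s i }
           ; ρ'-in-dom = λ { zero → d'≤k' ; (suc i) → ρ'-in-dom s i }
           ; P-iff     = λ { zero → d-iff ; (suc i) → P-iff s i } }

  similar-forth-world : ∀ {k ρ k' ρ' u} → Similar k ρ k' ρ' → k ≤ u →
                        Σ ℕ λ u' → k' ≤ u' × Similar u ρ u' ρ'
  similar-forth-world {k' = k'} s k≤u with m≤n⇒m<n∨m≡n k≤u
  ... | inj₂ refl = k' , ≤-refl , s
  ... | inj₁ k<u  = suc k' , n≤1+n k' ,
    all-old-similar (≤-<-trans z≤n k<u) (s≤s z≤n)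
                    (λ i → <⇒≤pred (≤-<-trans (ρ-in-dom s i) k<u)) (ρ'-in-dom s)

  newborn-lacks-P : ∀ {k} → 1 ≤ k → ¬ k ≤ pred k
  newborn-lacks-P {suc k} _ = 1+n≰n

  lacks-P⇒not-root : ∀ {k d} → d ≤ k → ¬ d ≤ pred k → 1 ≤ k
  lacks-P⇒not-root {zero}  d≤0 ¬old = ⊥-elim (¬old d≤0)
  lacks-P⇒not-root {suc k} _   _    = s≤s z≤n

  -- An old element is matched by 0, a newborn one by the newborn k'.
  similar-forth-element : ∀ {k ρ k' ρ' d} → Similar k ρ k' ρ' → d ≤ k →
                          Σ ℕ λ d' → d' ≤ k' × Similar k (extend d ρ) k' (extend d' ρ')
  similar-forth-element {k} {k' = k'} {d = d} s d≤k with d ≤? pred k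
  ... | yes old = 0 , z≤n , extend-similar s d≤k z≤n (mk⇔ (λ _ → z≤n) (λ _ → old))
  ... | no new  = k' , ≤-refl ,
    extend-similar s d≤k ≤-refl (mk⇔ (⊥-elim ∘ new) (⊥-elim ∘ newborn-lacks-P 1≤k'))
    where
    1≤k' : 1 ≤ k'
    1≤k' = to (Q-iff s) (lacks-P⇒not-root d≤k new)

  similarity : Bisimulation
  similarity = record
    { Related        = Similar
    ; symmetric      = similar-sym
    ; atom-preserved = atom-preserved
    ; forth-world    = similar-forth-world
    ; forth-element  = similar-forth-element
    }
    where
    atom-preserved : ∀ {k ρ k' ρ' P ts} → Similar k ρ k' ρ' →
                     k ⊩ atom P ts [ ρ ] → k' ⊩ atom P ts [ ρ' ]
    atom-preserved {P = 0} {t ∷ _} s = to (P-iff s t)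
    atom-preserved {P = 1}         s = to (Q-iff s)

  open Bisimulation similarity using (⊩-preserved)

  -- If B first holds at some v > u, H gives a witness x ≤ v there; at v + 1 the
  -- element x is old, so (v + 1, x) is similar to (v, 0), and 0 exists at u.
  ed-valid-growing : ∀ A B → Valid (ed A B)
  ed-valid-growing A B w ρ ρ∈w u w≤u H = ⊩-cases goal (u ⊩ B [ ρ ]) B-now B-not-now
    where
    goal : Formula
    goal = ∃' (shift B ⇒ A)

    ρ∈u : ∀ i → ρ i ≤ u
    ρ∈u i = ≤-trans (ρ∈w i) w≤u

    B-now : u ⊩ B [ ρ ] → u ⊩ goal [ ρ ]
    B-now b = ⊩-from-¬¬ goal (H u ≤-refl b) λ (d , d∈u , a) ¬e →
      ¬e (d , d∈u , λ v u≤v _ → ⊩-mono A u≤v a)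

    B-not-now : ¬ u ⊩ B [ ρ ] → u ⊩ goal [ ρ ]
    B-not-now ¬b ¬e = ¬e (0 , z≤n , λ v u≤v b → A-at-0 v u≤v (to (⊩-shift B) b))
      where
      A-at-0 : ∀ v → u ≤ v → v ⊩ B [ ρ ] → v ⊩ A [ extend 0 ρ ]
      A-at-0 v u≤v b with m≤n⇒m<n∨m≡n u≤v
      ... | inj₂ refl = ⊥-elim (¬b b)
      ... | inj₁ u<v  = ⊩-from-¬¬ A (H v u≤v b) λ (x , x≤v , a) →
        ⊩-preserved A (all-old-similar (s≤s z≤n) (≤-<-trans z≤n u<v)
                         (λ { zero → x≤v ; (suc i) → ≤-trans (ρ∈u i) u≤v })
                         (λ { zero → z≤n ; (suc i) → <⇒≤pred (≤-<-trans (ρ∈u i) u<v) }))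
                      (⊩-mono A (n≤1+n v) a)

  cd-underivable : ¬ (ED ⊢ cd Px Q)
  cd-underivable = underivable (validates-schema ed ed-valid-growing) cd-invalid

mainTheorem10 : NotDerives (CD ∪ SW) ed
    × NotDerives (CD ∪ ED) sw
    × Derives SW cd
    × NotDerives ED cd
mainTheorem10 =
  (Px , Q  , RootedDescendingChain.ed-underivable) ,
  (Px , ⊥' , OmegaChain.sw-underivable) ,
  sw⊢cd ,
  (Px , Q  , GrowingChain.cd-underivable)
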